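{- Let $k\geq 2$, let $G=(V,E)$ be a graph and let $u,v\in V$ with $uv\notin E$ be fake neighbors. Let $C_u$ be the connected component of $G-N(v)$ containing $u$, and $C_v$ the connected component of $G-N(u)$ containing $v$. Then $|V(C_u)|\leq k-1$ and $|V(C_v)|\leq k-1$; in particular, the connected component(s) of $G-(N(u)\cap N(v))$ containing $u$ and $v$ have at most $|V(C_u)\cup V(C_v)|\leq 2k-2$ vertices in total. Moreover, if $|V(C_u)\cup V(C_v)|\leq k-1$, then $G$ is not uniquely reconstructible, i.e. there is a graph $G'\neq G$ on $V$ with $\mathcal{S}_k(G')=\mathcal{S}_k(G)$ and $\overline{\mathcal{S}}_k(G')=\overline{\mathcal{S}}_k(G)$.
   Context: $\mathcal{S}_k(G)$ (resp. $\overline{\mathcal{S}}_k(G)$) denotes the set of $k$-subsets of $V$ inducing a connected (resp. disconnected) subgraph of $G$. For $uv\notin E$, $u$ and $v$ are clear non-neighbors if (i) there exists $S\in\mathcal{S}_k(G)$ with $v\in S$, $u\notin S$ such that for every $v'\in S\setminus\{v\}$, $(S\setminus\{v'\})\cup\{u\}\in\overline{\mathcal{S}}_k(G)$, or (ii) the same holds with the roles of $u$ and $v$ exchanged; otherwise $u$ and $v$ are fake neighbors. $N(x)$ is the open neighbourhood of $x$ in $G$. -}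

module Defs where

open import Data.Nat using (ℕ)
open import Data.Bool using (Bool; true; false)
open import Data.Fin using (Fin)
open import Data.Fin.Subset using (Subset; _∈_; _∉_; _∪_; _∩_; _-_; ⁅_⁆; ∣_∣; ∁)
open import Data.Vec using (tabulate)
open import Data.Product using (Σ; _×_; _,_)
open import Data.Sum using (_⊎_)
open import Relation.Nullary using (¬_)
open import Relation.Binary.PropositionalEquality using (_≡_; _≢_)

record Graph (n : ℕ) : Set where
  field
    adj    : Fin n → Fin n → Bool
    sym    : ∀ x y → adj x y ≡ adj y x
    irrefl : ∀ x → adj x x ≡ false
open Graph public

module _ {n : ℕ} (G : Graph n) where

  Edge : Fin n → Fin n → Set
  Edge x y = adj G x y ≡ true

  N : Fin n → Subset n
  N x = tabulate (adj G x)

  data Reach (T : Subset n) : Fin n → Fin n → Set where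
    here : ∀ {x} → x ∈ T → Reach T x x
    step : ∀ {x y z} → x ∈ T → Edge x y → Reach T y z → Reach T x z

  Connected : Subset n → Set
  Connected S = ∀ x y → x ∈ S → y ∈ S → Reach S x y

  ConnK : ℕ → Subset n → Set
  ConnK k S = (∣ S ∣ ≡ k) × Connected S

  DisconnK : ℕ → Subset n → Set
  DisconnK k S = (∣ S ∣ ≡ k) × ¬ Connected S

  -- condition (i) of the definition, with (v,u) in the given order:
  -- ∃ S ∈ 𝒮_k(G), v ∈ S, u ∉ S, ∀ v' ∈ S∖{v}, (S∖{v'}) ∪ {u} ∈ 𝒮̄_k(G)
  ClearWitness : ℕ → Fin n → Fin n → Set
  ClearWitness k u v =
    Σ (Subset n) λ S → ConnK k S × v ∈ S × u ∉ S ×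
      (∀ v' → v' ∈ S → v' ≢ v → DisconnK k ((S - v') ∪ ⁅ u ⁆))

  ClearNonNeighbors : ℕ → Fin n → Fin n → Set
  ClearNonNeighbors k u v = ¬ Edge u v × (ClearWitness k u v ⊎ ClearWitness k v u)

  FakeNeighbors : ℕ → Fin n → Fin n → Set
  FakeNeighbors k u v = ¬ Edge u v × ¬ ClearNonNeighbors k u v

  IsComponent : Subset n → Fin n → Subset n → Set
  IsComponent T x C = ∀ y → (y ∈ C → Reach T x y) × (Reach T x y → y ∈ C)

NotUniquelyReconstructible : {n : ℕ} → ℕ → Graph n → Set
NotUniquelyReconstructible {n} k G =
  Σ (Graph n) λ G' →
    (Σ (Fin n) λ x → Σ (Fin n) λ y → adj G' x y ≢ adj G x y) ×
    (∀ S → (ConnK G' k S → ConnK G k S) × (ConnK G k S → ConnK G' k S)) ×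
    (∀ S → (DisconnK G' k S → DisconnK G k S) × (DisconnK G k S → DisconnK G' k S))

-- If a connected k-set S containing u lay inside the component C_u of G − N(v), swapping any
-- other vertex of S for v would isolate v, so S would witness that u, v are clear non-neighbours;
-- hence |C_u| ≤ k − 1. A walk avoiding N(u) ∩ N(v) that starts at u or v stays inside C_u ∪ C_v:
-- a vertex adjacent to u (resp. v) but not to v (resp. u) is reached directly from u (resp. v),
-- and any other vertex continues the current walk. Running the same argument along walks of
-- G + uv inside a connected k-set S ∋ u, v, some walk must leave C_u ∪ C_v once |C_u ∪ C_v| < k;
-- it can only do so at a common neighbour of u and v in S, which joins u and v inside G[S]. So
-- G and G + uv have the same connected k-sets.
module Submission where

open import Data.Bool using (true; false; _∨_)
open import Data.Bool.Properties using (∨-zeroʳ)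
open import Data.Fin using (Fin; zero; suc; _≟_)
open import Data.Fin.Subset
  using (Subset; inside; outside; _∈_; _∉_; _⊆_; _∪_; _∩_; _-_; ∁; ⁅_⁆; ∣_∣)
open import Data.Fin.Subset.Properties
  using ( _∈?_; x∈p∪q⁻; x∈p∩q⁺; x∈p∩q⁻; p∩q⊆q; p⊆p∪q; q⊆p∪q; x∈⁅x⁆; x∈⁅y⁆⇒x≡y
        ; ∣⁅x⁆∣≡1; x∈∁p⇒x∉p; x∉p⇒x∈∁p; p⊆q⇒∣p∣≤∣q∣; p─q⊆p; x∈p∧x≢y⇒x∈p-y
        ; ∪-identityʳ; p─⊥≡p)
open import Data.Nat using (ℕ; zero; suc; _+_; _∸_; _*_; _≤_; _<_; s≤s; z≤n; _≤?_)
open import Data.Nat.Properties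
  using (≤-trans; ≤-reflexive; n≤1+n; ≰⇒>; +-mono-≤; +-monoʳ-≤; +-suc; +-identityʳ; *-distribˡ-∸)
open import Data.Product using (∃; ∃₂; _×_; _,_; proj₁; proj₂)
open import Data.Sum using (_⊎_; inj₁; inj₂; [_,_])
import Data.Sum as Sum
open import Data.Vec using (_∷_; []; tabulate; here; there)
open import Data.Vec.Properties using (lookup∘tabulate; []=⇒lookup; lookup⇒[]=)
open import Function using (_∘_)
open import Function.Bundles using (mk⇔)
open import Relation.Binary.PropositionalEquality using (_≡_; _≢_; refl; cong; cong₂; trans; subst)
import Relation.Binary.PropositionalEquality as ≡
open import Relation.Nullary using (¬_; Dec; yes; no; does; contradiction)
open import Relation.Nullary.Decidable using (dec-true; dec-false; does-⇔; _×-dec_; _⊎-dec_)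

open import Defs

∣p∪⁅x⁆∣≡1+∣p∣ : ∀ {n} (p : Subset n) {x} → x ∉ p → ∣ p ∪ ⁅ x ⁆ ∣ ≡ suc ∣ p ∣
∣p∪⁅x⁆∣≡1+∣p∣ (inside ∷ p) {zero} x∉p = contradiction here x∉p
∣p∪⁅x⁆∣≡1+∣p∣ (outside ∷ p) {zero} _ = cong (suc ∘ ∣_∣) (∪-identityʳ p)
∣p∪⁅x⁆∣≡1+∣p∣ (inside ∷ p) {suc x} x∉p = cong suc (∣p∪⁅x⁆∣≡1+∣p∣ p (x∉p ∘ there))
∣p∪⁅x⁆∣≡1+∣p∣ (outside ∷ p) {suc x} x∉p = ∣p∪⁅x⁆∣≡1+∣p∣ p (x∉p ∘ there)

1+∣p-x∣≡∣p∣ : ∀ {n} (p : Subset n) {x} → x ∈ p → suc ∣ p - x ∣ ≡ ∣ p ∣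
1+∣p-x∣≡∣p∣ (inside ∷ p) here = cong (suc ∘ ∣_∣) (p─⊥≡p p)
1+∣p-x∣≡∣p∣ (inside ∷ p) (there x∈p) = cong suc (1+∣p-x∣≡∣p∣ p x∈p)
1+∣p-x∣≡∣p∣ (outside ∷ p) (there x∈p) = 1+∣p-x∣≡∣p∣ p x∈p

∣p∪q∣≤∣p∣+∣q∣ : ∀ {n} (p q : Subset n) → ∣ p ∪ q ∣ ≤ ∣ p ∣ + ∣ q ∣
∣p∪q∣≤∣p∣+∣q∣ [] [] = z≤n
∣p∪q∣≤∣p∣+∣q∣ (inside ∷ p) (inside ∷ q) =
  s≤s (≤-trans (∣p∪q∣≤∣p∣+∣q∣ p q) (+-monoʳ-≤ ∣ p ∣ (n≤1+n ∣ q ∣)))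
∣p∪q∣≤∣p∣+∣q∣ (inside ∷ p) (outside ∷ q) = s≤s (∣p∪q∣≤∣p∣+∣q∣ p q)
∣p∪q∣≤∣p∣+∣q∣ (outside ∷ p) (inside ∷ q) =
  ≤-trans (s≤s (∣p∪q∣≤∣p∣+∣q∣ p q)) (≤-reflexive (≡.sym (+-suc ∣ p ∣ ∣ q ∣)))
∣p∪q∣≤∣p∣+∣q∣ (outside ∷ p) (outside ∷ q) = ∣p∪q∣≤∣p∣+∣q∣ p q

x∈p⇒⁅x⁆⊆p : ∀ {n} {p : Subset n} {x} → x ∈ p → ⁅ x ⁆ ⊆ p
x∈p⇒⁅x⁆⊆p {x = x} x∈p y∈⁅x⁆ = subst (_∈ _) (≡.sym (x∈⁅y⁆⇒x≡y x y∈⁅x⁆)) x∈p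

p⊆r∧x∈r⇒p∪⁅x⁆⊆r : ∀ {n} {p r : Subset n} {x} → p ⊆ r → x ∈ r → p ∪ ⁅ x ⁆ ⊆ r
p⊆r∧x∈r⇒p∪⁅x⁆⊆r {p = p} {x = x} p⊆r x∈r y∈ =
  [ p⊆r , x∈p⇒⁅x⁆⊆p x∈r ] (x∈p∪q⁻ p ⁅ x ⁆ y∈)

∈∉-there : ∀ {n s t} {p q : Subset n} →
  (∃ λ x → x ∈ q × x ∉ p) → ∃ λ x → x ∈ s ∷ q × x ∉ t ∷ p
∈∉-there (x , x∈q , x∉p) = suc x , there x∈q , λ { (there x∈p) → x∉p x∈p }

∣p∣<∣q∣⇒∃x∈q∧x∉p : ∀ {n} (p q : Subset n) → ∣ p ∣ < ∣ q ∣ → ∃ λ x → x ∈ q × x ∉ p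
∣p∣<∣q∣⇒∃x∈q∧x∉p (outside ∷ p) (inside ∷ q) _ = zero , here , λ ()
∣p∣<∣q∣⇒∃x∈q∧x∉p (inside ∷ p) (inside ∷ q) (s≤s lt) = ∈∉-there (∣p∣<∣q∣⇒∃x∈q∧x∉p p q lt)
∣p∣<∣q∣⇒∃x∈q∧x∉p (inside ∷ p) (outside ∷ q) lt =
  ∈∉-there (∣p∣<∣q∣⇒∃x∈q∧x∉p p q (≤-trans (n≤1+n _) lt))
∣p∣<∣q∣⇒∃x∈q∧x∉p (outside ∷ p) (outside ∷ q) lt = ∈∉-there (∣p∣<∣q∣⇒∃x∈q∧x∉p p q lt)

k+k≡2*[1+k]∸2 : ∀ k → k + k ≡ 2 * suc k ∸ 2
k+k≡2*[1+k]∸2 k = trans (cong (k +_) (≡.sym (+-identityʳ k))) (*-distribˡ-∸ 2 (suc k) 1)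

module _ {n : ℕ} (G : Graph n) where

  Edge-sym : ∀ {x y} → Edge G x y → Edge G y x
  Edge-sym {x} {y} e = trans (sym G y x) e

  Edge⇒∈N : ∀ {x y} → Edge G x y → y ∈ N G x
  Edge⇒∈N {x} {y} e = lookup⇒[]= y (tabulate (adj G x)) (trans (lookup∘tabulate (adj G x) y) e)

  ∈N⇒Edge : ∀ {x y} → y ∈ N G x → Edge G x y
  ∈N⇒Edge {x} {y} y∈Nx = trans (≡.sym (lookup∘tabulate (adj G x) y)) ([]=⇒lookup y∈Nx)

  x∈∁Nx : ∀ x → x ∈ ∁ (N G x)
  x∈∁Nx x = x∉p⇒x∈∁p λ x∈Nx → contradiction (trans (≡.sym (irrefl G x)) (∈N⇒Edge x∈Nx)) λ ()

  Reach-source : ∀ {T x y} → Reach G T x y → x ∈ T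
  Reach-source (here x∈T) = x∈T
  Reach-source (step x∈T _ _) = x∈T

  Reach-target : ∀ {T x y} → Reach G T x y → y ∈ T
  Reach-target (here y∈T) = y∈T
  Reach-target (step _ _ r) = Reach-target r

  Reach-mono : ∀ {T T′ x y} → T ⊆ T′ → Reach G T x y → Reach G T′ x y
  Reach-mono T⊆T′ (here x∈T) = here (T⊆T′ x∈T)
  Reach-mono T⊆T′ (step x∈T e r) = step (T⊆T′ x∈T) e (Reach-mono T⊆T′ r)

  Reach-trans : ∀ {T x y z} → Reach G T x y → Reach G T y z → Reach G T x z
  Reach-trans (here _) r′ = r′
  Reach-trans (step x∈T e r) r′ = step x∈T e (Reach-trans r r′)

  Reach-snoc : ∀ {T x y z} → Reach G T x y → Edge G y z → z ∈ T → Reach G T x z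
  Reach-snoc r e z∈T = Reach-trans r (step (Reach-target r) e (here z∈T))

  Reach-sym : ∀ {T x y} → Reach G T x y → Reach G T y x
  Reach-sym (here x∈T) = here x∈T
  Reach-sym (step x∈T e r) = Reach-snoc (Reach-sym r) (Edge-sym e) x∈T

  Reach-⊆∁N⇒≡ : ∀ {T x z} → T ⊆ ∁ (N G x) → Reach G T x z → x ≡ z
  Reach-⊆∁N⇒≡ T⊆∁Nx (here _) = refl
  Reach-⊆∁N⇒≡ T⊆∁Nx (step _ e r) = contradiction (Edge⇒∈N e) (x∈∁p⇒x∉p (T⊆∁Nx (Reach-source r)))

  Reach-crossing : ∀ {T a y} (S : Subset n) → Reach G T a y → a ∈ S → y ∉ S →
                   ∃₂ λ p q → p ∈ S × q ∉ S × q ∈ T × Edge G p q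
  Reach-crossing S (here _) a∈S y∉S = contradiction a∈S y∉S
  Reach-crossing S (step {x} {b} _ e r) a∈S y∉S with b ∈? S
  ... | yes b∈S = Reach-crossing S r b∈S y∉S
  ... | no b∉S = x , b , a∈S , b∉S , Reach-source r , e

  connected-hub : ∀ {S h} → (∀ {x} → x ∈ S → Reach G S x h) → Connected G S
  connected-hub to-h x y x∈S y∈S = Reach-trans (to-h x∈S) (Reach-sym (to-h y∈S))

  connected-⁅x⁆ : ∀ x → Connected G ⁅ x ⁆
  connected-⁅x⁆ x = connected-hub λ y∈⁅x⁆ →
    subst (λ y → Reach G ⁅ x ⁆ y x) (≡.sym (x∈⁅y⁆⇒x≡y x y∈⁅x⁆)) (here (x∈⁅x⁆ x))

  connected-∪⁅x⁆ : ∀ {S p q} → Connected G S → p ∈ S → Edge G p q → Connected G (S ∪ ⁅ q ⁆)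
  connected-∪⁅x⁆ {S} {p} {q} S-conn p∈S e = connected-hub to-q
    where
    q∈S′ : q ∈ S ∪ ⁅ q ⁆
    q∈S′ = q⊆p∪q S ⁅ q ⁆ (x∈⁅x⁆ q)
    to-q : ∀ {x} → x ∈ S ∪ ⁅ q ⁆ → Reach G (S ∪ ⁅ q ⁆) x q
    to-q {x} x∈S′ with x∈p∪q⁻ S ⁅ q ⁆ x∈S′
    ... | inj₁ x∈S = Reach-snoc (Reach-mono (p⊆p∪q ⁅ q ⁆) (S-conn x p x∈S p∈S)) e q∈S′
    ... | inj₂ x∈⁅q⁆ = subst (λ y → Reach G (S ∪ ⁅ q ⁆) y q) (≡.sym (x∈⁅y⁆⇒x≡y q x∈⁅q⁆)) (here q∈S′)

  module _ {T : Subset n} {x : Fin n} {C : Subset n} (C-comp : IsComponent G T x C) where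

    ∈component : ∀ {y} → Reach G T x y → y ∈ C
    ∈component r = proj₂ (C-comp _) r

    component-reach : ∀ {y} → y ∈ C → Reach G T x y
    component-reach y∈C = proj₁ (C-comp _) y∈C

    component-boundary : ∀ {S} → S ⊆ C → x ∈ S → ∣ S ∣ < ∣ C ∣ →
                         ∃₂ λ p q → p ∈ S × q ∉ S × q ∈ C × Edge G p q
    component-boundary {S} S⊆C x∈S ∣S∣<∣C∣ with ∣p∣<∣q∣⇒∃x∈q∧x∉p S C ∣S∣<∣C∣
    ... | y , y∈C , y∉S with Reach-crossing S (component-reach y∈C) x∈S y∉S
    ... | p , q , p∈S , q∉S , q∈T , e =
      p , q , p∈S , q∉S , ∈component (Reach-snoc (component-reach (S⊆C p∈S)) e q∈T) , e

    connected-subset : x ∈ T → ∀ m → suc m ≤ ∣ C ∣ →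
                       ∃ λ S → S ⊆ C × x ∈ S × ∣ S ∣ ≡ suc m × Connected G S
    connected-subset x∈T zero _ =
      ⁅ x ⁆ , x∈p⇒⁅x⁆⊆p (∈component (here x∈T)) , x∈⁅x⁆ x , ∣⁅x⁆∣≡1 x , connected-⁅x⁆ x
    connected-subset x∈T (suc m) 2+m≤∣C∣ with connected-subset x∈T m (≤-trans (n≤1+n _) 2+m≤∣C∣)
    ... | S , S⊆C , x∈S , ∣S∣≡1+m , S-conn
        with component-boundary S⊆C x∈S (subst (_< ∣ C ∣) (≡.sym ∣S∣≡1+m) 2+m≤∣C∣)
    ... | p , q , p∈S , q∉S , q∈C , e =
      S ∪ ⁅ q ⁆ , p⊆r∧x∈r⇒p∪⁅x⁆⊆r S⊆C q∈C , p⊆p∪q ⁅ q ⁆ x∈S ,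
      trans (∣p∪⁅x⁆∣≡1+∣p∣ S q∉S) (cong suc ∣S∣≡1+m) , connected-∪⁅x⁆ S-conn p∈S e

module _ {n : ℕ} (G : Graph n) {u v : Fin n} (u≢v : u ≢ v) (u≁v : ¬ Edge G u v)
         {C : Subset n} (C-comp : IsComponent G (∁ (N G v)) u C) where

  large-component⇒clearWitness : ∀ {k} → suc k ≤ ∣ C ∣ → ClearWitness G (suc k) v u
  large-component⇒clearWitness {k} large
    with connected-subset G C-comp (x∉p⇒x∈∁p (u≁v ∘ Edge-sym G ∘ ∈N⇒Edge G)) k large
  ... | S , S⊆C , u∈S , ∣S∣≡1+k , S-conn = S , (∣S∣≡1+k , S-conn) , u∈S , v∉S , swap-disconnected
    where
    S⊆∁Nv : S ⊆ ∁ (N G v)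
    S⊆∁Nv y∈S = Reach-target G (component-reach G C-comp (S⊆C y∈S))

    v∉S : v ∉ S
    v∉S v∈S = u≢v (≡.sym (Reach-⊆∁N⇒≡ G (λ z → z)
                              (Reach-sym G (component-reach G C-comp (S⊆C v∈S)))))

    swap-disconnected : ∀ w → w ∈ S → w ≢ u → DisconnK G (suc k) ((S - w) ∪ ⁅ v ⁆)
    swap-disconnected w w∈S w≢u = size , disconnected
      where
      S-w⊆S : S - w ⊆ S
      S-w⊆S = p─q⊆p S ⁅ w ⁆

      size : ∣ (S - w) ∪ ⁅ v ⁆ ∣ ≡ suc k
      size = trans (∣p∪⁅x⁆∣≡1+∣p∣ (S - w) (v∉S ∘ S-w⊆S)) (trans (1+∣p-x∣≡∣p∣ S w∈S) ∣S∣≡1+k)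

      disconnected : ¬ Connected G ((S - w) ∪ ⁅ v ⁆)
      disconnected S′-conn = u≢v (≡.sym (Reach-⊆∁N⇒≡ G
        (p⊆r∧x∈r⇒p∪⁅x⁆⊆r (S⊆∁Nv ∘ S-w⊆S) (x∈∁Nx G v))
        (S′-conn v u (q⊆p∪q (S - w) ⁅ v ⁆ (x∈⁅x⁆ v))
                     (p⊆p∪q ⁅ v ⁆ (x∈p∧x≢y⇒x∈p-y u∈S (w≢u ∘ ≡.sym))))))

  component-bound : ∀ {k} → ¬ ClearWitness G (suc k) v u → ∣ C ∣ ≤ k
  component-bound {k} ¬witness with ∣ C ∣ ≤? k
  ... | yes ∣C∣≤k = ∣C∣≤k
  ... | no ∣C∣≰k = contradiction (large-component⇒clearWitness (≰⇒> ∣C∣≰k)) ¬witness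

IsPair : ∀ {n} → Fin n → Fin n → Fin n → Fin n → Set
IsPair u v x y = (x ≡ u × y ≡ v) ⊎ (x ≡ v × y ≡ u)

isPair? : ∀ {n} (u v x y : Fin n) → Dec (IsPair u v x y)
isPair? u v x y = (x ≟ u ×-dec y ≟ v) ⊎-dec (x ≟ v ×-dec y ≟ u)

IsPair-sym : ∀ {n} {u v x y : Fin n} → IsPair u v x y → IsPair u v y x
IsPair-sym (inj₁ (x≡u , y≡v)) = inj₂ (y≡v , x≡u)
IsPair-sym (inj₂ (x≡v , y≡u)) = inj₁ (y≡u , x≡v)

IsPair-irrefl : ∀ {n} {u v x : Fin n} → u ≢ v → ¬ IsPair u v x x
IsPair-irrefl u≢v (inj₁ (refl , refl)) = u≢v refl
IsPair-irrefl u≢v (inj₂ (refl , refl)) = u≢v refl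

WithinAddEdge : ∀ {n} → Graph n → Fin n → Fin n → Graph n → Set
WithinAddEdge G u v H = ∀ {x y} → Edge H x y → Edge G x y ⊎ IsPair u v x y

addEdge : ∀ {n} (G : Graph n) {u v : Fin n} → u ≢ v → Graph n
addEdge G {u} {v} u≢v = record
  { adj    = λ x y → adj G x y ∨ does (isPair? u v x y)
  ; sym    = λ x y → cong₂ _∨_ (sym G x y)
                       (does-⇔ (mk⇔ IsPair-sym IsPair-sym) (isPair? u v x y) (isPair? u v y x))
  ; irrefl = λ x → cong₂ _∨_ (irrefl G x) (dec-false (isPair? u v x x) (IsPair-irrefl u≢v))
  }

module _ {n : ℕ} (G : Graph n) {u v : Fin n} (u≢v : u ≢ v) where

  addEdge-Edge⁺ : ∀ {x y} → Edge G x y → Edge (addEdge G u≢v) x y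
  addEdge-Edge⁺ {x} {y} e = cong (_∨ does (isPair? u v x y)) e

  addEdge-uv : Edge (addEdge G u≢v) u v
  addEdge-uv = trans (cong (adj G u v ∨_) (dec-true (isPair? u v u v) (inj₁ (refl , refl))))
                     (∨-zeroʳ (adj G u v))

  addEdge-within : WithinAddEdge G u v (addEdge G u≢v)
  addEdge-within {x} {y} = split (adj G x y) refl (isPair? u v x y)
    where
    split : ∀ b → adj G x y ≡ b → (p? : Dec (IsPair u v x y)) → b ∨ does p? ≡ true →
            Edge G x y ⊎ IsPair u v x y
    split true  xy∈E _        _ = inj₁ xy∈E
    split false _    (yes p)  _ = inj₂ p
    split false _    (no _)   ()

module _ {n : ℕ} {G H : Graph n} where

  Connected-lift : (∀ {x y} → Edge G x y → Edge H x y) → ∀ {S} → Connected G S → Connected H S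
  Connected-lift G⊆H S-conn x y x∈S y∈S = lift (S-conn x y x∈S y∈S)
    where
    lift : ∀ {S x y} → Reach G S x y → Reach H S x y
    lift (here x∈S) = here x∈S
    lift (step x∈S e r) = step x∈S (G⊆H e) (lift r)

  Connected-unlift : ∀ {u v} → WithinAddEdge G u v H → ∀ {S} → (u ∈ S → v ∈ S → Reach G S u v) →
                     Connected H S → Connected G S
  Connected-unlift H⊆G+uv {S} u~v S-conn x y x∈S y∈S = unlift (S-conn x y x∈S y∈S)
    where
    unlift : ∀ {x y} → Reach H S x y → Reach G S x y
    unlift (here x∈S) = here x∈S
    unlift (step x∈S e r) with H⊆G+uv e
    ... | inj₁ e′ = step x∈S e′ (unlift r)
    ... | inj₂ (inj₁ (refl , refl)) = Reach-trans G (u~v x∈S (Reach-source H r)) (unlift r)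
    ... | inj₂ (inj₂ (refl , refl)) =
      Reach-trans G (Reach-sym G (u~v (Reach-source H r) x∈S)) (unlift r)

sameConnectedSets⇒notUniquelyReconstructible :
  ∀ {n k} {G : Graph n} (G′ : Graph n) (x y : Fin n) → adj G′ x y ≢ adj G x y →
  (∀ S → ∣ S ∣ ≡ k → Connected G S → Connected G′ S) →
  (∀ S → ∣ S ∣ ≡ k → Connected G′ S → Connected G S) →
  NotUniquelyReconstructible k G
sameConnectedSets⇒notUniquelyReconstructible G′ x y differ to from =
  G′ , (x , y , differ) ,
  (λ S → (λ (size , c) → size , from S size c) , (λ (size , c) → size , to S size c)) ,
  (λ S → (λ (size , ¬c) → size , ¬c ∘ to S size) , (λ (size , ¬c) → size , ¬c ∘ from S size))

module _ {n : ℕ} (G : Graph n) {u v : Fin n} (u≁v : ¬ Edge G u v) where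

  u∉Nv : u ∉ N G v
  u∉Nv = u≁v ∘ Edge-sym G ∘ ∈N⇒Edge G

  v∉Nu : v ∉ N G u
  v∉Nu = u≁v ∘ ∈N⇒Edge G

  ∈-∩∁ : ∀ {S X : Subset n} {y} → y ∈ S → y ∉ X → y ∈ S ∩ ∁ X
  ∈-∩∁ y∈S y∉X = x∈p∩q⁺ (y∈S , x∉p⇒x∈∁p y∉X)

  Near : Subset n → Fin n → Set
  Near S x = Reach G (S ∩ ∁ (N G v)) u x ⊎ Reach G (S ∩ ∁ (N G u)) v x

  module _ {S : Subset n} (u∈S : u ∈ S) (v∈S : v ∈ S) where

    Near-u : Near S u
    Near-u = inj₁ (here (∈-∩∁ u∈S u∉Nv))

    Near-v : Near S v
    Near-v = inj₂ (here (∈-∩∁ v∈S v∉Nu))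

    Near-step : ∀ {x y} → Near S x → Edge G x y → y ∈ S → Near S y ⊎ y ∈ N G u ∩ N G v
    Near-step {y = y} near e y∈S with y ∈? N G u | y ∈? N G v
    ... | yes y∈Nu | yes y∈Nv = inj₂ (x∈p∩q⁺ (y∈Nu , y∈Nv))
    ... | yes y∈Nu | no y∉Nv =
      inj₁ (inj₁ (step (∈-∩∁ u∈S u∉Nv) (∈N⇒Edge G y∈Nu) (here (∈-∩∁ y∈S y∉Nv))))
    ... | no y∉Nu | yes y∈Nv =
      inj₁ (inj₂ (step (∈-∩∁ v∈S v∉Nu) (∈N⇒Edge G y∈Nv) (here (∈-∩∁ y∈S y∉Nu))))
    ... | no y∉Nu | no y∉Nv =
      inj₁ (Sum.map (λ r → Reach-snoc G r e (∈-∩∁ y∈S y∉Nv))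
                    (λ r → Reach-snoc G r e (∈-∩∁ y∈S y∉Nu)) near)

    Near-walk : ∀ {H x w} → WithinAddEdge G u v H → Reach H S x w → Near S x →
                Near S w ⊎ ∃ λ y → y ∈ S × y ∈ N G u ∩ N G v
    Near-walk H⊆G+uv (here _) near = inj₁ near
    Near-walk {H} H⊆G+uv (step {y = y} _ e r) near with H⊆G+uv e
    ... | inj₂ (inj₁ (_ , refl)) = Near-walk H⊆G+uv r Near-v
    ... | inj₂ (inj₂ (_ , refl)) = Near-walk H⊆G+uv r Near-u
    ... | inj₁ e′ with Near-step near e′ (Reach-source H r)
    ...   | inj₁ near′ = Near-walk H⊆G+uv r near′
    ...   | inj₂ y∈Nu∩Nv = inj₂ (y , Reach-source H r , y∈Nu∩Nv)

  module _ {Cu Cv : Subset n} (Cu-comp : IsComponent G (∁ (N G v)) u Cu)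
           (Cv-comp : IsComponent G (∁ (N G u)) v Cv) where

    Near⇒∈Cu∪Cv : ∀ {S w} → Near S w → w ∈ Cu ∪ Cv
    Near⇒∈Cu∪Cv {S} (inj₁ r) = p⊆p∪q Cv (∈component G Cu-comp (Reach-mono G (p∩q⊆q S _) r))
    Near⇒∈Cu∪Cv {S} (inj₂ r) = q⊆p∪q Cu Cv (∈component G Cv-comp (Reach-mono G (p∩q⊆q S _) r))

    ∁common-components⊆ : ∀ {Du Dv} →
      IsComponent G (∁ (N G u ∩ N G v)) u Du → IsComponent G (∁ (N G u ∩ N G v)) v Dv →
      Du ∪ Dv ⊆ Cu ∪ Cv
    ∁common-components⊆ {Du} {Dv} Du-comp Dv-comp w∈ =
      [ (λ w∈Du → along (component-reach G Du-comp w∈Du) (Near-u u∈T v∈T))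
      , (λ w∈Dv → along (component-reach G Dv-comp w∈Dv) (Near-v u∈T v∈T))
      ] (x∈p∪q⁻ Du Dv w∈)
      where
      T = ∁ (N G u ∩ N G v)
      u∈T : u ∈ T
      u∈T = x∉p⇒x∈∁p (u∉Nv ∘ proj₂ ∘ x∈p∩q⁻ (N G u) (N G v))
      v∈T : v ∈ T
      v∈T = x∉p⇒x∈∁p (v∉Nu ∘ proj₁ ∘ x∈p∩q⁻ (N G u) (N G v))
      along : ∀ {x w} → Reach G T x w → Near T x → w ∈ Cu ∪ Cv
      along r near with Near-walk u∈T v∈T inj₁ r near
      ... | inj₁ near′ = Near⇒∈Cu∪Cv near′
      ... | inj₂ (_ , y∈T , y∈Nu∩Nv) = contradiction y∈Nu∩Nv (x∈∁p⇒x∉p y∈T)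

    module _ (u≢v : u ≢ v) {k : ℕ} (small : ∣ Cu ∪ Cv ∣ < k) where

      addEdge-linked : ∀ {S} → ∣ S ∣ ≡ k → Connected (addEdge G u≢v) S →
                       u ∈ S → v ∈ S → Reach G S u v
      addEdge-linked {S} ∣S∣≡k S-conn u∈S v∈S
        with ∣p∣<∣q∣⇒∃x∈q∧x∉p (Cu ∪ Cv) S (subst (∣ Cu ∪ Cv ∣ <_) (≡.sym ∣S∣≡k) small)
      ... | w , w∈S , w∉Cu∪Cv
          with Near-walk u∈S v∈S (addEdge-within G u≢v) (S-conn u w u∈S w∈S) (Near-u u∈S v∈S)
      ... | inj₁ near = contradiction (Near⇒∈Cu∪Cv near) w∉Cu∪Cv
      ... | inj₂ (y , y∈S , y∈Nu∩Nv) with x∈p∩q⁻ (N G u) (N G v) y∈Nu∩Nv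
      ...   | y∈Nu , y∈Nv =
        step u∈S (∈N⇒Edge G y∈Nu) (step y∈S (Edge-sym G (∈N⇒Edge G y∈Nv)) (here v∈S))

      addEdge-notUniquelyReconstructible : NotUniquelyReconstructible k G
      addEdge-notUniquelyReconstructible =
        sameConnectedSets⇒notUniquelyReconstructible (addEdge G u≢v) u v
          (λ eq → u≁v (trans (≡.sym eq) (addEdge-uv G u≢v)))
          (λ _ _ → Connected-lift (addEdge-Edge⁺ G u≢v))
          (λ _ ∣S∣≡k S-conn →
            Connected-unlift (addEdge-within G u≢v) (addEdge-linked ∣S∣≡k S-conn) S-conn)

lemma5 : ∀ {n : ℕ} (k : ℕ) → 2 ≤ k → (G : Graph n) → (u v : Fin n) → u ≢ v →
    FakeNeighbors G k u v →
    (Cu Cv Du Dv : Subset n) →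
    IsComponent G (∁ (N G v)) u Cu →
    IsComponent G (∁ (N G u)) v Cv →
    IsComponent G (∁ (N G u ∩ N G v)) u Du →
    IsComponent G (∁ (N G u ∩ N G v)) v Dv →
    (∣ Cu ∣ ≤ k ∸ 1) × (∣ Cv ∣ ≤ k ∸ 1) ×
    (∣ Du ∪ Dv ∣ ≤ ∣ Cu ∪ Cv ∣) × (∣ Cu ∪ Cv ∣ ≤ 2 * k ∸ 2) ×
    (∣ Cu ∪ Cv ∣ ≤ k ∸ 1 → NotUniquelyReconstructible k G)
lemma5 (suc k) _ G u v u≢v (u≁v , ¬clear) Cu Cv Du Dv Cu-comp Cv-comp Du-comp Dv-comp =
  ∣Cu∣≤k , ∣Cv∣≤k ,
  p⊆q⇒∣p∣≤∣q∣ (∁common-components⊆ G u≁v Cu-comp Cv-comp Du-comp Dv-comp) ,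
  ≤-trans (∣p∪q∣≤∣p∣+∣q∣ Cu Cv) (≤-trans (+-mono-≤ ∣Cu∣≤k ∣Cv∣≤k) (≤-reflexive (k+k≡2*[1+k]∸2 k))) ,
  λ ∣Cu∪Cv∣≤k → addEdge-notUniquelyReconstructible G u≁v Cu-comp Cv-comp u≢v (s≤s ∣Cu∪Cv∣≤k)
  where
  ∣Cu∣≤k : ∣ Cu ∣ ≤ k
  ∣Cu∣≤k = component-bound G u≢v u≁v Cu-comp (λ witness → ¬clear (u≁v , inj₂ witness))
  ∣Cv∣≤k : ∣ Cv ∣ ≤ k
  ∣Cv∣≤k = component-bound G (u≢v ∘ ≡.sym) (u≁v ∘ Edge-sym G) Cv-comp
                           (λ witness → ¬clear (u≁v , inj₁ witness))
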